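{- Let $b\ge 2$ be an integer and let $k,n$ be nonnegative integers with $b^k\leq n<b^{k+1}$. Then $n$ can be written uniquely as $n=jb^k+t$ with $j\in\{1,\ldots,b-1\}$ and $t\in\{0,1,\ldots,b^k-1\}$. Moreover $s_b(n)\leq F_{k+2}$, with equality if and only if $t=h_k$ or $t=h_{k+1}$.
   Context: Fix an integer $b\ge 2$. A base $b$ over-expansion of a positive integer $N$ is a word $d_kd_{k-1}\cdots d_0$ over $\{0,1,\ldots,b\}$ with $d_k\neq 0$ and $\sum_{i=0}^k d_ib^i=N$. For $n\ge 2$, $s_b(n)$ is the number of base $b$ over-expansions of $n-1$; $s_b(0)=0$, $s_b(1)=1$. The integers $h_m$ are defined by $h_0=0$, $h_1=h_2=1$ and, for $m\geq 3$, $h_m=1+\sum_{i=0}^{\lfloor (m-3)/2\rfloor}b^{m-2-2i}$. $F_j$ are the Fibonacci numbers with $F_1=F_2=1$. -}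

module Defs where

open import Data.Nat using (ℕ; zero; suc; _+_; _*_; _∸_; _^_; _/_; _≟_)
open import Data.Nat.Properties using ()
open import Data.Fin using (Fin; toℕ)
open import Data.Fin.Properties using ()
open import Data.Vec using (Vec; []; _∷_; head; foldl)
open import Data.List using (List; []; _∷_; concatMap; map; length; filter; allFin; upTo)
open import Data.Product using (_×_)
open import Relation.Nullary using (¬_; Dec; yes; no)
open import Relation.Nullary.Decidable using (_×-dec_; ¬?)
open import Relation.Binary.PropositionalEquality using (_≡_)

-- A word d_k d_{k-1} ... d_0 over {0,...,b} is a vector of length k+1
-- of elements of Fin (suc b), most significant digit first.
Word : ℕ → ℕ → Set
Word b len = Vec (Fin (suc b)) len

value : ∀ {len} (b : ℕ) → Word b len → ℕ
value b w = foldl (λ _ → ℕ) (λ acc d → acc * b + toℕ d) 0 w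

IsOverExp : (b N k : ℕ) → Word b (suc k) → Set
IsOverExp b N k w = (¬ (toℕ (head w) ≡ 0)) × (value b w ≡ N)

isOverExp? : (b N k : ℕ) → (w : Word b (suc k)) → Dec (IsOverExp b N k w)
isOverExp? b N k w = ¬? (toℕ (head w) ≟ 0) ×-dec (value b w ≟ N)

allWords : (b len : ℕ) → List (Word b len)
allWords b zero = [] ∷ []
allWords b (suc len) =
  concatMap (λ d → map (d ∷_) (allWords b len)) (allFin (suc b))

countLen : (b N k : ℕ) → ℕ
countLen b N k = length (filter (isOverExp? b N k) (allWords b (suc k)))

-- Any over-expansion d_k...d_0 of N
-- (b ≥ 2) satisfies 2^k ≤ b^k ≤ N, hence k < N; so summing over
-- k = 0, ..., N-1 counts all of them (for N = 0 there are none).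
sumList : List ℕ → ℕ
sumList [] = 0
sumList (x ∷ xs) = x + sumList xs

overExpCount : (b N : ℕ) → ℕ
overExpCount b N = sumList (map (countLen b N) (upTo N))

s : ℕ → ℕ → ℕ
s b zero = 0
s b (suc zero) = 1
s b (suc (suc m)) = overExpCount b (suc m)

fib : ℕ → ℕ
fib zero = 0
fib (suc zero) = 1
fib (suc (suc n)) = fib (suc n) + fib n

h : ℕ → ℕ → ℕ
h b zero = 0
h b (suc zero) = 1
h b (suc (suc zero)) = 1
h b m@(suc (suc (suc _))) =
  1 + sumList (map (λ i → b ^ (m ∸ 2 ∸ 2 * i)) (upTo (suc ((m ∸ 3) / 2))))

-- Write σ(N) = s_b(N + 1) for the number of over-expansions of N, counting the empty one for
-- N = 0.  The last digit of an over-expansion of r + q b (r < b) is r, or b when r = 0, so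
-- σ(r + q b) = σ(q) + [r = 0] s_b(q).  Hence on pairs (s_b(n), s_b(n + 1)) appending a digit d
-- acts by (x, y) ↦ (x, x + y), (x + y, y) or (y, y) for d = 0, 1 or d ≥ 2, and a leading digit
-- gives (1, 1).  By induction on k, after k steps both entries are at most F(k+2) and their sum
-- at most F(k+3), the sum being maximal only at two digit strings t, the peaks, where the pair is
-- (F(k+2), F(k+1)) or (F(k+1), F(k+2)).  The first entry reaches F(k+2) only by the digit 1
-- applied after a maximal sum, and appending digits alternately keeps one peak and adds b^k to
-- the other, which is how h(k+2) = b^k + h(k) arises.

module Submission where

open import Defs
open import Data.Nat using (ℕ; zero; suc; _+_; _*_; _∸_; _^_; _≤_; _<_; _≟_; z≤n; s≤s; NonZero; >-nonZero⁻¹; _/_; _%_)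
open import Data.Nat.Properties
open import Data.Nat.DivMod
open import Data.Nat.Tactic.RingSolver using (solve-∀)
open import Data.Bool using (true; false; if_then_else_)
open import Data.Fin using (Fin; toℕ) renaming (zero to fzero; suc to fsuc)
open import Data.Vec using (_∷_; foldl)
open import Data.List using (List; []; _∷_; _++_; concatMap; map; length; filter; allFin; applyUpTo; tabulate)
open import Data.List.Properties using (length-++; filter-++; filter-none; map-tabulate; map-cong)
open import Data.List.Relation.Unary.All using (universal)
import Data.List.Relation.Unary.All.Properties as All
open import Data.Product using (Σ; _×_; _,_; proj₁; proj₂; swap)
open import Data.Empty using (⊥-elim)
open import Data.Sum using (_⊎_; inj₁; inj₂) renaming (swap to ⊎-swap)
open import Relation.Nullary using (Dec; does; yes; no; ¬_)
open import Relation.Nullary.Decidable using (dec-true; dec-false)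
open import Relation.Unary using (Pred; Decidable)
open import Relation.Binary.PropositionalEquality
open import Level using (0ℓ)
open import Function using (_∘_; id)
open import Function.Bundles using (_⇔_; mk⇔)
open import Function.Properties.Equivalence using () renaming (trans to ⇔-trans)
open import Algebra.Properties.CommutativeSemigroup +-commutativeSemigroup
  using () renaming (interchange to +-interchange)

∑< : ℕ → (ℕ → ℕ) → ℕ
∑< zero    f = 0
∑< (suc n) f = ∑< n f + f n

syntax ∑< n (λ i → e) = ∑[ i < n ] e

∑<-unfoldˡ : ∀ n f → ∑< (suc n) f ≡ f 0 + ∑< n (f ∘ suc)
∑<-unfoldˡ zero    f = +-comm 0 (f 0)
∑<-unfoldˡ (suc n) f = trans (cong (_+ f (suc n)) (∑<-unfoldˡ n f)) (+-assoc (f 0) _ _)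

∑<-cong : ∀ n {f g} → (∀ {i} → i < n → f i ≡ g i) → ∑< n f ≡ ∑< n g
∑<-cong zero    eq = refl
∑<-cong (suc n) eq = cong₂ _+_ (∑<-cong n (eq ∘ m<n⇒m<1+n)) (eq ≤-refl)

∑<-zeros : ∀ n {f} → (∀ {i} → i < n → f i ≡ 0) → ∑< n f ≡ 0
∑<-zeros zero    eq = refl
∑<-zeros (suc n) eq = cong₂ _+_ (∑<-zeros n (eq ∘ m<n⇒m<1+n)) (eq ≤-refl)

∑<-distrib-+ : ∀ n f g → ∑[ i < n ] (f i + g i) ≡ ∑< n f + ∑< n g
∑<-distrib-+ zero    f g = refl
∑<-distrib-+ (suc n) f g =
  trans (cong (_+ (f n + g n)) (∑<-distrib-+ n f g)) (+-interchange (∑< n f) (∑< n g) (f n) (g n))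

*-distribˡ-∑< : ∀ n c f → c * ∑< n f ≡ ∑[ i < n ] (c * f i)
*-distribˡ-∑< zero    c f = *-zeroʳ c
*-distribˡ-∑< (suc n) c f =
  trans (*-distribˡ-+ c (∑< n f) (f n)) (cong (_+ c * f n) (*-distribˡ-∑< n c f))

sumList-map-applyUpTo : ∀ n (f g : ℕ → ℕ) → sumList (map f (applyUpTo g n)) ≡ ∑[ i < n ] f (g i)
sumList-map-applyUpTo zero    f g = refl
sumList-map-applyUpTo (suc n) f g =
  trans (cong (f (g 0) +_) (sumList-map-applyUpTo n f (g ∘ suc))) (sym (∑<-unfoldˡ n (f ∘ g)))

sumList-tabulate : ∀ n (f : ℕ → ℕ) → sumList (tabulate {n = n} (f ∘ toℕ)) ≡ ∑< n f
sumList-tabulate zero    f = refl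
sumList-tabulate (suc n) f = trans (cong (f 0 +_) (sumList-tabulate n (f ∘ suc))) (sym (∑<-unfoldˡ n f))

sumList-map-allFin : ∀ n (f : ℕ → ℕ) → sumList (map (f ∘ toℕ) (allFin n)) ≡ ∑< n f
sumList-map-allFin n f = trans (cong sumList (map-tabulate {n = n} id (f ∘ toℕ))) (sumList-tabulate n f)

module _ {A : Set} {P : Pred A 0ℓ} (P? : Decidable P) where

  length-filter-concatMap : ∀ {B : Set} (f : B → List A) (xs : List B) →
    length (filter P? (concatMap f xs)) ≡ sumList (map (λ x → length (filter P? (f x))) xs)
  length-filter-concatMap f []       = refl
  length-filter-concatMap f (x ∷ xs) = begin
    length (filter P? (f x ++ concatMap f xs))
      ≡⟨ cong length (filter-++ P? (f x) _) ⟩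
    length (filter P? (f x) ++ filter P? (concatMap f xs))
      ≡⟨ length-++ (filter P? (f x)) ⟩
    length (filter P? (f x)) + length (filter P? (concatMap f xs))
      ≡⟨ cong (length (filter P? (f x)) +_) (length-filter-concatMap f xs) ⟩
    _ ∎
    where open ≡-Reasoning

  length-filter-map : ∀ {B : Set} {Q : Pred B 0ℓ} (Q? : Decidable Q) (f : B → A) (xs : List B) →
    (∀ x → does (P? (f x)) ≡ does (Q? x)) → length (filter P? (map f xs)) ≡ length (filter Q? xs)
  length-filter-map Q? f []       agree = refl
  length-filter-map Q? f (x ∷ xs) agree with does (P? (f x)) | does (Q? x) | agree x
  ... | true  | true  | _ = cong suc (length-filter-map Q? f xs agree)
  ... | false | false | _ = length-filter-map Q? f xs agree

δ : ℕ → ℕ → ℕ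
δ a c = if does (a ≟ c) then 1 else 0

δ-refl : ∀ a → δ a a ≡ 1
δ-refl a rewrite dec-true (a ≟ a) refl = refl

δ-≢ : ∀ {a c} → ¬ a ≡ c → δ a c ≡ 0
δ-≢ {a} {c} a≢c rewrite dec-false (a ≟ c) a≢c = refl

∑<-δ : ∀ {m d} → d < m → ∑[ i < m ] δ i d ≡ 1
∑<-δ {suc m} {d} d<1+m with d ≟ m
... | yes refl = cong₂ _+_ (∑<-zeros m (λ i<m → δ-≢ (<⇒≢ i<m))) (δ-refl m)
... | no d≢m   = cong₂ _+_ (∑<-δ (≤∧≢⇒< (≤-pred d<1+m) d≢m)) (δ-≢ (d≢m ∘ sym))

divMod-unique : ∀ {D} .{{_ : NonZero D}} {d r} a q → d < D → r < D →
  d + a * D ≡ r + q * D → d ≡ r × a ≡ q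
divMod-unique {D} {d} {r} a q d<D r<D eq =
  d≡r , *-cancelʳ-≡ a q D (+-cancelˡ-≡ d _ _ (trans eq (cong (_+ q * D) (sym d≡r))))
  where
  open ≡-Reasoning
  d≡r : d ≡ r
  d≡r = begin
    d               ≡⟨ sym (m<n⇒m%n≡m d<D) ⟩
    d % D           ≡⟨ sym ([m+kn]%n≡m%n d a D) ⟩
    (d + a * D) % D ≡⟨ cong (_% D) eq ⟩
    (r + q * D) % D ≡⟨ [m+kn]%n≡m%n r q D ⟩
    r % D           ≡⟨ m<n⇒m%n≡m r<D ⟩
    r               ∎

δ-digits : ∀ {D} .{{_ : NonZero D}} {d r} a q → d < D → r < D →
  δ (d + a * D) (r + q * D) ≡ δ d r * δ a q
δ-digits {d = d} {r} a q d<D r<D with d ≟ r | a ≟ q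
... | yes refl | yes refl = trans (δ-refl (d + a * _)) (sym (cong₂ _*_ (δ-refl d) (δ-refl a)))
... | no d≢r   | _        =
  trans (δ-≢ (d≢r ∘ proj₁ ∘ divMod-unique a q d<D r<D)) (sym (cong (_* δ a q) (δ-≢ d≢r)))
... | yes refl | no a≢q   =
  trans (δ-≢ (a≢q ∘ proj₂ ∘ divMod-unique a q d<D r<D))
        (sym (trans (cong (δ d d *_) (δ-≢ a≢q)) (*-zeroʳ (δ d d))))

divMod-digit : ∀ {D} .{{_ : NonZero D}} {d} t → d < D → (d + t * D) % D ≡ d × (d + t * D) / D ≡ t
divMod-digit {D} {d} t d<D =
  divMod-unique _ t (m%n<n (d + t * D) D) d<D (sym (m≡m%n+[m/n]*n (d + t * D) D))

atPred : (ℕ → ℕ) → ℕ → ℕ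
atPred f zero    = 0
atPred f (suc q) = f q

∑<-atPred : ∀ n (f : ℕ → ℕ → ℕ) q → ∑[ i < n ] atPred (f i) q ≡ atPred (λ p → ∑[ i < n ] f i p) q
∑<-atPred n f zero    = ∑<-zeros n (λ _ → refl)
∑<-atPred n f (suc q) = refl

atPred-δ : ∀ a q → atPred (δ a) q ≡ δ (suc a) q
atPred-δ a zero    = refl
atPred-δ a (suc q) = refl

n<m^n : ∀ {m} → 1 < m → ∀ n → n < m ^ n
n<m^n 1<m zero    = s≤s z≤n
n<m^n 1<m (suc n) = ≤-<-trans (n<m^n 1<m n) (^-monoʳ-< _ 1<m (n<1+n n))

+-squeeze : ∀ {a c A C} → a ≤ A → c ≤ C → a + c ≡ A + C → a ≡ A × c ≡ C
+-squeeze {a} {c} {A} {C} a≤A c≤C eq =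
  ≤-antisym a≤A (+-cancelʳ-≤ C A a (subst (_≤ a + C) eq (+-monoʳ-≤ a c≤C))) ,
  ≤-antisym c≤C (+-cancelˡ-≤ A C c (subst (_≤ A + c) eq (+-monoˡ-≤ c a≤A)))

fib-≤ : ∀ k → fib (1 + k) ≤ fib (2 + k)
fib-≤ k = m≤m+n (fib (1 + k)) (fib k)

fib-pos : ∀ k → 1 ≤ fib (1 + k)
fib-pos zero    = ≤-refl
fib-pos (suc k) = ≤-trans (fib-pos k) (fib-≤ k)

fib-< : ∀ k → fib (2 + k) < fib (3 + k)
fib-< k = subst (_≤ fib (3 + k)) (+-comm (fib (2 + k)) 1) (+-monoʳ-≤ (fib (2 + k)) (fib-pos k))

fib-1+k≡fib-2+k⇒k≡0 : ∀ k → fib (1 + k) ≡ fib (2 + k) → k ≡ 0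
fib-1+k≡fib-2+k⇒k≡0 zero    _  = refl
fib-1+k≡fib-2+k⇒k≡0 (suc k) eq = ⊥-elim (<-irrefl eq (fib-< k))

h-3+q : ∀ B q → h B (3 + q) ≡ suc (∑[ i < suc (q / 2) ] (B ^ (suc q ∸ 2 * i)))
h-3+q B q = cong suc (sumList-map-applyUpTo (suc (q / 2)) (λ i → B ^ (suc q ∸ 2 * i)) id)

h-2+m : ∀ B m → h B (2 + m) ≡ B ^ m + h B m
h-2+m B zero                = refl
h-2+m B (suc zero)          = trans (cong suc (+-identityʳ (B ^ 1))) (+-comm 1 (B ^ 1))
h-2+m B (suc (suc zero))    = trans (cong suc (+-identityʳ (B ^ 2))) (+-comm 1 (B ^ 2))
h-2+m B (suc (suc (suc q))) = begin
  h B (5 + q)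
    ≡⟨ h-3+q B (2 + q) ⟩
  suc (∑[ i < suc ((2 + q) / 2) ] (B ^ (3 + q ∸ 2 * i)))
    ≡⟨ cong (λ m → suc (∑[ i < suc m ] (B ^ (3 + q ∸ 2 * i))))
            (m/n≡1+[m∸n]/n {2 + q} {2} (s≤s (s≤s z≤n))) ⟩
  suc (∑[ i < 2 + q / 2 ] (B ^ (3 + q ∸ 2 * i)))
    ≡⟨ cong suc (∑<-unfoldˡ (suc (q / 2)) (λ i → B ^ (3 + q ∸ 2 * i))) ⟩
  suc (B ^ (3 + q) + ∑[ i < suc (q / 2) ] (B ^ (3 + q ∸ 2 * suc i)))
    ≡⟨ cong (λ x → suc (B ^ (3 + q) + x))
            (∑<-cong (suc (q / 2)) (λ {i} _ → cong (λ j → B ^ (2 + q ∸ j)) (+-suc i (i + 0)))) ⟩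
  suc (B ^ (3 + q) + ∑[ i < suc (q / 2) ] (B ^ (suc q ∸ 2 * i)))
    ≡⟨ sym (+-suc (B ^ (3 + q)) _) ⟩
  B ^ (3 + q) + suc (∑[ i < suc (q / 2) ] (B ^ (suc q ∸ 2 * i)))
    ≡⟨ cong (B ^ (3 + q) +_) (sym (h-3+q B q)) ⟩
  B ^ (3 + q) + h B (3 + q) ∎
  where open ≡-Reasoning

≡-either-⇔ : ∀ {t u v x y : ℕ} → (u ≡ x × v ≡ y) ⊎ (u ≡ y × v ≡ x) →
  (t ≡ u ⊎ t ≡ v) ⇔ (t ≡ x ⊎ t ≡ y)
≡-either-⇔ (inj₁ (refl , refl)) = mk⇔ id id
≡-either-⇔ (inj₂ (refl , refl)) = mk⇔ ⊎-swap ⊎-swap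

step : ℕ → ℕ × ℕ → ℕ × ℕ
step zero          (x , y) = x , x + y
step (suc zero)    (x , y) = x + y , y
step (suc (suc _)) (x , y) = y , y

-- Counting digit strings

module Counting (b : ℕ) where

  evalFrom : ∀ {L} → ℕ → Word b L → ℕ
  evalFrom a w = foldl (λ _ → ℕ) (λ acc d → acc * b + toℕ d) a w

  completions : ℕ → ℕ → ℕ → ℕ
  completions zero    a N = δ a N
  completions (suc L) a N = ∑[ d < suc b ] completions L (a * b + d) N

  length-filter-evalFrom : ∀ L a N →
    length (filter (λ w → evalFrom a w ≟ N) (allWords b L)) ≡ completions L a N
  length-filter-evalFrom zero    a N with does (a ≟ N)
  ... | true  = refl
  ... | false = refl
  length-filter-evalFrom (suc L) a N = begin
    length (filter (evalsTo? a) (concatMap extend (allFin (suc b))))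
      ≡⟨ length-filter-concatMap (evalsTo? a) extend (allFin (suc b)) ⟩
    sumList (map (λ d → length (filter (evalsTo? a) (extend d))) (allFin (suc b)))
      ≡⟨ cong sumList (map-cong digit (allFin (suc b))) ⟩
    sumList (map (completionsAfter ∘ toℕ) (allFin (suc b)))
      ≡⟨ sumList-map-allFin (suc b) completionsAfter ⟩
    completions (suc L) a N ∎
    where
    open ≡-Reasoning
    evalsTo? : ∀ {M} a (w : Word b M) → Dec (evalFrom a w ≡ N)
    evalsTo? a w = evalFrom a w ≟ N
    extend : Fin (suc b) → List (Word b (suc L))
    extend d = map (d ∷_) (allWords b L)
    completionsAfter : ℕ → ℕ
    completionsAfter d = completions L (a * b + d) N
    digit : ∀ d → length (filter (evalsTo? a) (extend d)) ≡ completionsAfter (toℕ d)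
    digit d = trans (length-filter-map (evalsTo? a) (evalsTo? (a * b + toℕ d)) (d ∷_) (allWords b L) (λ _ → refl))
                    (length-filter-evalFrom L (a * b + toℕ d) N)

  countLen-completions : ∀ N k → countLen b N k ≡ ∑[ i < b ] completions k (suc i) N
  countLen-completions N k = begin
    countLen b N k
      ≡⟨ length-filter-concatMap (isOverExp? b N k) extend (allFin (suc b)) ⟩
    sumList (map (λ d → length (filter (isOverExp? b N k) (extend d))) (allFin (suc b)))
      ≡⟨ cong sumList (map-cong leading (allFin (suc b))) ⟩
    sumList (map (count ∘ toℕ) (allFin (suc b)))
      ≡⟨ sumList-map-allFin (suc b) count ⟩
    ∑< (suc b) count
      ≡⟨ ∑<-unfoldˡ b count ⟩
    ∑[ i < b ] completions k (suc i) N ∎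
    where
    open ≡-Reasoning
    extend : Fin (suc b) → List (Word b (suc k))
    extend d = map (d ∷_) (allWords b k)
    count : ℕ → ℕ
    count zero    = 0
    count (suc i) = completions k (suc i) N
    leading : ∀ d → length (filter (isOverExp? b N k) (extend d)) ≡ count (toℕ d)
    leading fzero    = cong length (filter-none (isOverExp? b N k)
                         (All.map⁺ (universal (λ _ isOverExp → proj₁ isOverExp refl) (allWords b k))))
    leading (fsuc d) = trans (length-filter-map (isOverExp? b N k) (λ w → evalFrom (suc (toℕ d)) w ≟ N)
                                                (fsuc d ∷_) (allWords b k) (λ _ → refl))
                             (length-filter-evalFrom k (suc (toℕ d)) N)

  overExpCount-completions : ∀ N → overExpCount b N ≡ ∑[ k < N ] ∑[ i < b ] completions k (suc i) N
  overExpCount-completions N =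
    trans (sumList-map-applyUpTo N (countLen b N) id) (∑<-cong N (λ {k} _ → countLen-completions N k))

  completions-0-suc : ∀ L N →
    completions (suc L) 0 N ≡ completions L 0 N + ∑[ i < b ] completions L (suc i) N
  completions-0-suc L N = ∑<-unfoldˡ b (λ d → completions L d N)

  -- With leading zeros allowed, a word of value N is all zeros or zeros followed by an over-expansion.
  completions-0 : ∀ L N → completions L 0 N ≡ δ 0 N + ∑[ k < L ] ∑[ i < b ] completions k (suc i) N
  completions-0 zero    N = sym (+-identityʳ (δ 0 N))
  completions-0 (suc L) N =
    trans (completions-0-suc L N)
          (trans (cong (_+ ∑[ i < b ] completions L (suc i) N) (completions-0 L N)) (+-assoc (δ 0 N) _ _))

  s-suc≡completions-0 : ∀ N → s b (suc N) ≡ completions N 0 N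
  s-suc≡completions-0 zero    = refl
  s-suc≡completions-0 (suc N) =
    trans (overExpCount-completions (suc N)) (sym (completions-0 (suc N) (suc N)))

  completions-< : ∀ L a N → N < a * b ^ L → completions L a N ≡ 0
  completions-< zero    a N N<a = δ-≢ (λ a≡N → <⇒≢ N<a (sym (trans (*-identityʳ a) a≡N)))
  completions-< (suc L) a N N<a =
    ∑<-zeros (suc b) (λ {d} _ → completions-< L (a * b + d) N (<-≤-trans N<a (append d)))
    where
    append : ∀ d → a * b ^ suc L ≤ (a * b + d) * b ^ L
    append d = begin
      a * (b * b ^ L) ≡⟨ sym (*-assoc a b (b ^ L)) ⟩
      a * b * b ^ L   ≤⟨ *-monoˡ-≤ (b ^ L) (m≤m+n (a * b) d) ⟩
      (a * b + d) * b ^ L ∎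
      where open ≤-Reasoning

  -- The last digit is r, or b when r = 0; in the latter case the prefix has value q - 1.
  completions-snoc : .{{_ : NonZero b}} → ∀ L a q {r} → r < b →
    completions (suc L) a (r + q * b) ≡ completions L a q + δ 0 r * atPred (completions L a) q
  completions-snoc zero a q {r} r<b = cong₂ _+_ lastDigit lastDigitOverflow
    where
    open ≡-Reasoning
    lastDigit : ∑[ d < b ] δ (a * b + d) (r + q * b) ≡ δ a q
    lastDigit = begin
      ∑[ d < b ] δ (a * b + d) (r + q * b)
        ≡⟨ ∑<-cong b (λ {d} d<b → trans (cong (λ x → δ x (r + q * b)) (+-comm (a * b) d))
                                        (trans (δ-digits a q d<b r<b) (*-comm (δ d r) (δ a q)))) ⟩
      ∑[ d < b ] (δ a q * δ d r) ≡⟨ sym (*-distribˡ-∑< b (δ a q) (λ d → δ d r)) ⟩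
      δ a q * ∑[ d < b ] δ d r   ≡⟨ cong (δ a q *_) (∑<-δ r<b) ⟩
      δ a q * 1                  ≡⟨ *-identityʳ (δ a q) ⟩
      δ a q                      ∎
    lastDigitOverflow : δ (a * b + b) (r + q * b) ≡ δ 0 r * atPred (δ a) q
    lastDigitOverflow = begin
      δ (a * b + b) (r + q * b) ≡⟨ cong (λ x → δ x (r + q * b)) (+-comm (a * b) b) ⟩
      δ (0 + suc a * b) (r + q * b) ≡⟨ δ-digits (suc a) q (>-nonZero⁻¹ b) r<b ⟩
      δ 0 r * δ (suc a) q       ≡⟨ cong (δ 0 r *_) (sym (atPred-δ a q)) ⟩
      δ 0 r * atPred (δ a) q    ∎
  completions-snoc (suc L) a q {r} r<b = begin
    ∑[ d < suc b ] completions (suc L) (a * b + d) (r + q * b)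
      ≡⟨ ∑<-cong (suc b) (λ {d} _ → completions-snoc L (a * b + d) q r<b) ⟩
    ∑[ d < suc b ] (completions L (a * b + d) q + δ 0 r * atPred (completions L (a * b + d)) q)
      ≡⟨ ∑<-distrib-+ (suc b) _ _ ⟩
    completions (suc L) a q + ∑[ d < suc b ] (δ 0 r * atPred (completions L (a * b + d)) q)
      ≡⟨ cong (completions (suc L) a q +_) (sym (*-distribˡ-∑< (suc b) (δ 0 r) _)) ⟩
    completions (suc L) a q + δ 0 r * ∑[ d < suc b ] atPred (completions L (a * b + d)) q
      ≡⟨ cong (λ x → completions (suc L) a q + δ 0 r * x)
              (∑<-atPred (suc b) (λ d → completions L (a * b + d)) q) ⟩
    completions (suc L) a q + δ 0 r * atPred (completions (suc L) a) q ∎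
    where open ≡-Reasoning

-- The digit recurrence for s

module BaseAtLeastTwo (b' : ℕ) where

  b : ℕ
  b = suc (suc b')

  open Counting b

  completions-0-suc-stable : ∀ L {N} → N < b ^ L → completions (suc L) 0 N ≡ completions L 0 N
  completions-0-suc-stable L {N} N<b^L = begin
    completions (suc L) 0 N
      ≡⟨ completions-0-suc L N ⟩
    completions L 0 N + ∑[ i < b ] completions L (suc i) N
      ≡⟨ cong (completions L 0 N +_) (∑<-zeros b (λ {i} _ → completions-< L (suc i) N
                                                    (<-≤-trans N<b^L (m≤m+n (b ^ L) (i * b ^ L))))) ⟩
    completions L 0 N + 0
      ≡⟨ +-identityʳ _ ⟩
    completions L 0 N ∎
    where open ≡-Reasoning

  completions-0-stable : ∀ {N L} → N ≤ L → completions L 0 N ≡ completions N 0 N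
  completions-0-stable {N} {zero}  z≤n = refl
  completions-0-stable {N} {suc L} N≤1+L with N ≟ suc L
  ... | yes refl = refl
  ... | no N≢1+L = trans (completions-0-suc-stable L (≤-<-trans N≤L (n<m^n (s≤s (s≤s z≤n)) L)))
                         (completions-0-stable N≤L)
    where
    N≤L : N ≤ L
    N≤L = ≤-pred (≤∧≢⇒< N≤1+L N≢1+L)

  completions-0≡s : ∀ {q L} → q ≤ L → completions L 0 q ≡ s b (suc q)
  completions-0≡s {q} q≤L = trans (completions-0-stable q≤L) (sym (s-suc≡completions-0 q))

  atPred-completions-0≡s : ∀ {q L} → q ≤ L → atPred (completions L 0) q ≡ s b q
  atPred-completions-0≡s {zero}  _   = refl
  atPred-completions-0≡s {suc q} q<L = completions-0≡s (<⇒≤ q<L)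

  s-digit : ∀ q {r} → r < b → s b (suc (r + q * b)) ≡ s b (suc q) + δ 0 r * s b q
  s-digit q {r} r<b = begin
    s b (suc N)
      ≡⟨ s-suc≡completions-0 N ⟩
    completions N 0 N
      ≡⟨ sym (completions-0-stable (n≤1+n N)) ⟩
    completions (suc N) 0 N
      ≡⟨ completions-snoc N 0 q r<b ⟩
    completions N 0 q + δ 0 r * atPred (completions N 0) q
      ≡⟨ cong₂ (λ x y → x + δ 0 r * y) (completions-0≡s q≤N) (atPred-completions-0≡s q≤N) ⟩
    s b (suc q) + δ 0 r * s b q ∎
    where
    open ≡-Reasoning
    N : ℕ
    N = r + q * b
    q≤N : q ≤ N
    q≤N = ≤-trans (m≤m*n q b) (m≤n+m (q * b) r)

  s-digit-zero : ∀ q → s b (suc (q * b)) ≡ s b q + s b (suc q)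
  s-digit-zero q =
    trans (s-digit q (s≤s z≤n))
          (trans (cong (s b (suc q) +_) (+-identityʳ (s b q))) (+-comm (s b (suc q)) (s b q)))

  s-digit-nonzero : ∀ q {r} → suc r < b → s b (suc (suc r + q * b)) ≡ s b (suc q)
  s-digit-nonzero q r<b = trans (s-digit q r<b) (+-identityʳ _)

  s-*b : ∀ m → s b (m * b) ≡ s b m
  s-*b zero    = refl
  s-*b (suc q) = s-digit-nonzero q ≤-refl

  s-suc-digit : ∀ {r} → r < b → s b (suc r) ≡ 1
  s-suc-digit {r} r<b =
    trans (cong (s b ∘ suc) (sym (+-identityʳ r))) (trans (s-digit 0 r<b) (cong suc (*-zeroʳ (δ 0 r))))

  m<b^1+k⇒m/b<b^k : ∀ {m} k → m < b ^ suc k → m / b < b ^ k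
  m<b^1+k⇒m/b<b^k {m} k m<b^1+k = m<n*o⇒m/o<n (subst (m <_) (*-comm b (b ^ k)) m<b^1+k)

  sPair : ℕ → ℕ × ℕ
  sPair n = s b n , s b (suc n)

  sPair-digit : ∀ d m → d < b → sPair (d + m * b) ≡ step d (sPair m)
  sPair-digit zero             m _   = cong₂ _,_ (s-*b m) (s-digit-zero m)
  sPair-digit (suc zero)       m 1<b = cong₂ _,_ (s-digit-zero m) (s-digit-nonzero m 1<b)
  sPair-digit (suc (suc d))    m d<b = cong₂ _,_ (s-digit-nonzero m (<⇒≤ d<b)) (s-digit-nonzero m d<b)

  digitPair : ℕ → ℕ → ℕ × ℕ
  digitPair zero    t = 1 , 1
  digitPair (suc k) t = step (t % b) (digitPair k (t / b))

  digitPair-digit : ∀ k t {d} → d < b → digitPair (suc k) (d + t * b) ≡ step d (digitPair k t)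
  digitPair-digit k t d<b with divMod-digit t d<b
  ... | d%b≡d , d/b≡t = cong₂ step d%b≡d (cong (digitPair k) d/b≡t)

  sPair-leading : ∀ k t {j} → 1 ≤ j → j < b → t < b ^ k → sPair (t + j * b ^ k) ≡ digitPair k t
  sPair-leading zero    zero {suc i} _ j<b _ =
    trans (cong sPair (*-identityʳ (suc i))) (cong₂ _,_ (s-suc-digit (<⇒≤ j<b)) (s-suc-digit j<b))
  sPair-leading zero    (suc t) _ _ (s≤s ())
  sPair-leading (suc k) t {j} 1≤j j<b t<b^1+k = begin
    sPair (t + j * b ^ suc k)
      ≡⟨ cong sPair expand ⟩
    sPair (t % b + (t / b + j * b ^ k) * b)
      ≡⟨ sPair-digit (t % b) (t / b + j * b ^ k) (m%n<n t b) ⟩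
    step (t % b) (sPair (t / b + j * b ^ k))
      ≡⟨ cong (step (t % b)) (sPair-leading k (t / b) 1≤j j<b (m<b^1+k⇒m/b<b^k k t<b^1+k)) ⟩
    digitPair (suc k) t ∎
    where
    open ≡-Reasoning
    expand : t + j * b ^ suc k ≡ t % b + (t / b + j * b ^ k) * b
    expand = trans (cong (_+ j * b ^ suc k) (m≡m%n+[m/n]*n t b)) (arith (t % b) (t / b) j (b ^ k) b)
      where
      arith : ∀ r q c p B → (r + q * B) + c * (B * p) ≡ r + (q + c * p) * B
      arith = solve-∀

  -- The Fibonacci bound and its extremal cases

  fstPeak sndPeak : ℕ → ℕ
  fstPeak zero    = 0
  fstPeak (suc k) = suc (sndPeak k * b)
  sndPeak zero    = 0
  sndPeak (suc k) = fstPeak k * b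

  digitPair-fstPeak : ∀ k → digitPair k (fstPeak k) ≡ (fib (2 + k) , fib (1 + k))
  digitPair-sndPeak : ∀ k → digitPair k (sndPeak k) ≡ (fib (1 + k) , fib (2 + k))
  digitPair-fstPeak zero    = refl
  digitPair-fstPeak (suc k) = begin
    digitPair (suc k) (1 + sndPeak k * b) ≡⟨ digitPair-digit k (sndPeak k) (s≤s (s≤s z≤n)) ⟩
    step 1 (digitPair k (sndPeak k))      ≡⟨ cong (step 1) (digitPair-sndPeak k) ⟩
    (fib (1 + k) + fib (2 + k) , fib (2 + k)) ≡⟨ cong (_, fib (2 + k)) (+-comm (fib (1 + k)) (fib (2 + k))) ⟩
    (fib (3 + k) , fib (2 + k))           ∎
    where open ≡-Reasoning
  digitPair-sndPeak zero    = refl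
  digitPair-sndPeak (suc k) =
    trans (digitPair-digit k (fstPeak k) (s≤s z≤n)) (cong (step 0) (digitPair-fstPeak k))

  sndPeak≡fstPeak : ∀ {k} → k ≡ 0 → sndPeak k ≡ fstPeak k
  sndPeak≡fstPeak refl = refl

  Tight : ℕ → ℕ → ℕ → ℕ → Set
  Tight k t x y = (t ≡ fstPeak k × x ≡ fib (2 + k) × y ≡ fib (1 + k))
                ⊎ (t ≡ sndPeak k × x ≡ fib (1 + k) × y ≡ fib (2 + k))

  record FibBound (k t : ℕ) (p : ℕ × ℕ) : Set where
    field
      fst≤ : proj₁ p ≤ fib (2 + k)
      snd≤ : proj₂ p ≤ fib (2 + k)
      sum≤ : proj₁ p + proj₂ p ≤ fib (3 + k)
      tight : proj₁ p + proj₂ p ≡ fib (3 + k) → Tight k t (proj₁ p) (proj₂ p)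

  step-FibBound : ∀ {k t x y} d → FibBound k t (x , y) → FibBound (suc k) (d + t * b) (step d (x , y))
  step-FibBound {k} {t} {x} {y} zero bound = record
    { fst≤ = ≤-trans fst≤ (fib-≤ (suc k))
    ; snd≤ = sum≤
    ; sum≤ = subst (x + (x + y) ≤_) (+-comm (fib (2 + k)) (fib (3 + k))) (+-mono-≤ fst≤ sum≤)
    ; tight = λ eq → tight′ (+-squeeze fst≤ sum≤ (trans eq (+-comm (fib (3 + k)) (fib (2 + k)))))
    }
    where
    open FibBound bound
    tight′ : x ≡ fib (2 + k) × x + y ≡ fib (3 + k) → Tight (suc k) (t * b) x (x + y)
    tight′ (x≡ , x+y≡) with tight x+y≡
    ... | inj₁ (t≡ , _ , _)  = inj₂ (cong (_* b) t≡ , x≡ , x+y≡)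
    ... | inj₂ (t≡ , x≡′ , _) = inj₂ (cong (_* b) t≡fstPeak , x≡ , x+y≡)
      where
      t≡fstPeak : t ≡ fstPeak k
      t≡fstPeak = trans t≡ (sndPeak≡fstPeak (fib-1+k≡fib-2+k⇒k≡0 k (trans (sym x≡′) x≡)))
  step-FibBound {k} {t} {x} {y} (suc zero) bound = record
    { fst≤ = sum≤
    ; snd≤ = ≤-trans snd≤ (fib-≤ (suc k))
    ; sum≤ = +-mono-≤ sum≤ snd≤
    ; tight = λ eq → tight′ (+-squeeze sum≤ snd≤ eq)
    }
    where
    open FibBound bound
    tight′ : x + y ≡ fib (3 + k) × y ≡ fib (2 + k) → Tight (suc k) (1 + t * b) (x + y) y
    tight′ (x+y≡ , y≡) with tight x+y≡
    ... | inj₂ (t≡ , _ , _)  = inj₁ (cong (λ u → suc (u * b)) t≡ , x+y≡ , y≡)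
    ... | inj₁ (t≡ , _ , y≡′) = inj₁ (cong (λ u → suc (u * b)) t≡sndPeak , x+y≡ , y≡)
      where
      t≡sndPeak : t ≡ sndPeak k
      t≡sndPeak = trans t≡ (sym (sndPeak≡fstPeak (fib-1+k≡fib-2+k⇒k≡0 k (trans (sym y≡′) y≡))))
  step-FibBound {k} {t} {x} {y} (suc (suc d)) bound = record
    { fst≤ = y≤
    ; snd≤ = y≤
    ; sum≤ = +-mono-≤ y≤ snd≤
    ; tight = λ eq → ⊥-elim (<⇒≱ (fib-< k) (+-cancelʳ-≤ _ _ _
                (subst (_≤ fib (2 + k) + fib (2 + k)) eq (+-mono-≤ snd≤ snd≤))))
    }
    where
    open FibBound bound
    y≤ : y ≤ fib (3 + k)
    y≤ = ≤-trans snd≤ (fib-≤ (suc k))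

  digitPair-FibBound : ∀ k t → t < b ^ k → FibBound k t (digitPair k t)
  digitPair-FibBound zero zero _ = record
    { fst≤ = ≤-refl ; snd≤ = ≤-refl ; sum≤ = ≤-refl ; tight = λ _ → inj₁ (refl , refl , refl) }
  digitPair-FibBound zero (suc t) (s≤s ())
  digitPair-FibBound (suc k) t t<b^1+k =
    subst (λ u → FibBound (suc k) u (digitPair (suc k) t)) (sym (m≡m%n+[m/n]*n t b))
          (step-FibBound (t % b) (digitPair-FibBound k (t / b) (m<b^1+k⇒m/b<b^k k t<b^1+k)))

  step-fst-max : ∀ {k t x y} d → FibBound k t (x , y) → proj₁ (step d (x , y)) ≡ fib (3 + k) →
    d + t * b ≡ fstPeak (suc k) ⊎ d + t * b ≡ suc (sndPeak (suc k))
  step-fst-max {k} zero bound eq =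
    ⊥-elim (<⇒≱ (fib-< k) (subst (_≤ fib (2 + k)) eq (FibBound.fst≤ bound)))
  step-fst-max (suc zero) bound eq with FibBound.tight bound eq
  ... | inj₁ (t≡ , _) = inj₂ (cong (λ u → suc (u * b)) t≡)
  ... | inj₂ (t≡ , _) = inj₁ (cong (λ u → suc (u * b)) t≡)
  step-fst-max {k} (suc (suc d)) bound eq =
    ⊥-elim (<⇒≱ (fib-< k) (subst (_≤ fib (2 + k)) eq (FibBound.snd≤ bound)))

  digitPair-fst-max : ∀ k t → t < b ^ k →
    proj₁ (digitPair k t) ≡ fib (2 + k) ⇔ (t ≡ fstPeak k ⊎ t ≡ suc (sndPeak k))
  digitPair-fst-max zero    zero    _ = mk⇔ (λ _ → inj₁ refl) (λ _ → refl)
  digitPair-fst-max zero    (suc t) (s≤s ())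
  digitPair-fst-max (suc k) t t<b^1+k = mk⇔ to from
    where
    to : proj₁ (digitPair (suc k) t) ≡ fib (3 + k) → t ≡ fstPeak (suc k) ⊎ t ≡ suc (sndPeak (suc k))
    to eq = subst (λ u → u ≡ fstPeak (suc k) ⊎ u ≡ suc (sndPeak (suc k))) (sym (m≡m%n+[m/n]*n t b))
                  (step-fst-max (t % b) (digitPair-FibBound k (t / b) (m<b^1+k⇒m/b<b^k k t<b^1+k)) eq)
    from : t ≡ fstPeak (suc k) ⊎ t ≡ suc (sndPeak (suc k)) → proj₁ (digitPair (suc k) t) ≡ fib (3 + k)
    from (inj₁ refl) = cong proj₁ (digitPair-fstPeak (suc k))
    from (inj₂ refl) = cong proj₁ (trans (digitPair-digit k (fstPeak k) (s≤s (s≤s z≤n)))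
                                         (cong (step 1) (digitPair-fstPeak k)))

  -- Which peak equals h b k alternates with k; the second components carry the induction.
  EvenPeaks OddPeaks : ℕ → Set
  EvenPeaks k = (fstPeak k ≡ h b k × suc (sndPeak k) ≡ h b (suc k))
              × (sndPeak (suc k) ≡ sndPeak k × fstPeak (suc k) ≡ b ^ k + fstPeak k)
  OddPeaks k  = (fstPeak k ≡ h b (suc k) × suc (sndPeak k) ≡ h b k)
              × (fstPeak (suc k) ≡ fstPeak k × sndPeak (suc k) ≡ b ^ k + sndPeak k)

  [b^k+x]*b≡b^1+k+x*b : ∀ k x → (b ^ k + x) * b ≡ b ^ suc k + x * b
  [b^k+x]*b≡b^1+k+x*b k x = trans (*-distribʳ-+ b (b ^ k) x) (cong (_+ x * b) (*-comm (b ^ k) b))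

  EvenPeaks⇒OddPeaks : ∀ {k} → EvenPeaks k → OddPeaks (suc k)
  EvenPeaks⇒OddPeaks {k} ((fst≡ , snd≡) , (sndStays , fstGrows)) =
    ( trans fstGrows (trans (cong (b ^ k +_) fst≡) (sym (h-2+m b k)))
    , trans (cong suc sndStays) snd≡ )
    , ( cong (λ u → suc (u * b)) sndStays
      , trans (cong (_* b) fstGrows) ([b^k+x]*b≡b^1+k+x*b k (fstPeak k)) )

  OddPeaks⇒EvenPeaks : ∀ {k} → OddPeaks k → EvenPeaks (suc k)
  OddPeaks⇒EvenPeaks {k} ((fst≡ , snd≡) , (fstStays , sndGrows)) =
    ( trans fstStays fst≡
    , trans (cong suc sndGrows)
            (trans (sym (+-suc (b ^ k) (sndPeak k))) (trans (cong (b ^ k +_) snd≡) (sym (h-2+m b k)))) )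
    , ( cong (_* b) fstStays
      , trans (cong suc (trans (cong (_* b) sndGrows) ([b^k+x]*b≡b^1+k+x*b k (sndPeak k)))) (sym (+-suc (b ^ suc k) _)) )

  EvenPeaks⊎OddPeaks : ∀ k → EvenPeaks k ⊎ OddPeaks k
  EvenPeaks⊎OddPeaks zero = inj₁ ((refl , refl) , (refl , refl))
  EvenPeaks⊎OddPeaks (suc k) with EvenPeaks⊎OddPeaks k
  ... | inj₁ even = inj₂ (EvenPeaks⇒OddPeaks even)
  ... | inj₂ odd  = inj₁ (OddPeaks⇒EvenPeaks odd)

  peaks≡h : ∀ k → (fstPeak k ≡ h b k × suc (sndPeak k) ≡ h b (suc k))
                ⊎ (fstPeak k ≡ h b (suc k) × suc (sndPeak k) ≡ h b k)
  peaks≡h k with EvenPeaks⊎OddPeaks k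
  ... | inj₁ even = inj₁ (proj₁ even)
  ... | inj₂ odd  = inj₂ (proj₁ odd)

  s-leading : ∀ k t {j} → 1 ≤ j → j < b → t < b ^ k → s b (j * b ^ k + t) ≡ proj₁ (digitPair k t)
  s-leading k t {j} 1≤j j<b t<b^k =
    trans (cong (s b) (+-comm (j * b ^ k) t)) (cong proj₁ (sPair-leading k t 1≤j j<b t<b^k))

  s-≤-fib : ∀ k t {j n} → 1 ≤ j → j < b → t < b ^ k → n ≡ j * b ^ k + t → s b n ≤ fib (k + 2)
  s-≤-fib k t 1≤j j<b t<b^k refl rewrite +-comm k 2 | s-leading k t 1≤j j<b t<b^k =
    FibBound.fst≤ (digitPair-FibBound k t t<b^k)

  s≡fib-⇔ : ∀ k t {j n} → 1 ≤ j → j < b → t < b ^ k → n ≡ j * b ^ k + t →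
    s b n ≡ fib (k + 2) ⇔ (t ≡ h b k ⊎ t ≡ h b (suc k))
  s≡fib-⇔ k t 1≤j j<b t<b^k refl rewrite +-comm k 2 | s-leading k t 1≤j j<b t<b^k =
    ⇔-trans (digitPair-fst-max k t t<b^k) (≡-either-⇔ (peaks≡h k))

proposition6 : (b : ℕ) → 2 ≤ b → (k n : ℕ) → b ^ k ≤ n → n < b ^ suc k →
    Σ ℕ (λ j → Σ ℕ (λ t →
      ((1 ≤ j × j ≤ b ∸ 1 × t < b ^ k × n ≡ j * b ^ k + t)
      × ((j′ t′ : ℕ) → 1 ≤ j′ → j′ ≤ b ∸ 1 → t′ < b ^ k → n ≡ j′ * b ^ k + t′ →
           j′ ≡ j × t′ ≡ t)
      × s b n ≤ fib (k + 2)
      × (s b n ≡ fib (k + 2) ⇔ (t ≡ h b k ⊎ t ≡ h b (suc k))))))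
proposition6 b@(suc (suc b')) (s≤s (s≤s z≤n)) k n b^k≤n n<b^1+k =
  j , t , (1≤j , ≤-pred j<b , t<b^k , n≡) , unique ,
  s-≤-fib k t 1≤j j<b t<b^k n≡ , s≡fib-⇔ k t 1≤j j<b t<b^k n≡
  where
  open BaseAtLeastTwo b' hiding (b)
  instance
    b^k≢0 : NonZero (b ^ k)
    b^k≢0 = m^n≢0 b k
  j t : ℕ
  j = n / b ^ k
  t = n % b ^ k
  1≤j : 1 ≤ j
  1≤j = m≥n⇒m/n>0 b^k≤n
  j<b : j < b
  j<b = m<n*o⇒m/o<n n<b^1+k
  t<b^k : t < b ^ k
  t<b^k = m%n<n n (b ^ k)
  n≡ : n ≡ j * b ^ k + t
  n≡ = trans (m≡m%n+[m/n]*n n (b ^ k)) (+-comm t (j * b ^ k))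
  unique : ∀ j′ t′ → 1 ≤ j′ → j′ ≤ b ∸ 1 → t′ < b ^ k → n ≡ j′ * b ^ k + t′ → j′ ≡ j × t′ ≡ t
  unique j′ t′ _ _ t′<b^k n≡′ =
    swap (divMod-unique j′ j t′<b^k t<b^k
           (trans (+-comm t′ (j′ * b ^ k)) (trans (sym n≡′) (trans n≡ (+-comm (j * b ^ k) t)))))
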